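{- Let $S = Q_7 \setminus \big[(1^4\times Q_3^-) \cup \{0^4\times 0^3\}\cup\{0^4\times 1^3\}\big]$. Then $S$ can be partitioned as a disjoint union $S=\bigcup_{i=1}^{30} S_i$, where each $S_i$ is a $2$-dimensional subcube of $Q_7$.
   Context: $Q_k=\{0,1\}^k$; $0^k$, $1^k$ are the all-zero and all-one vectors; $Q_k^-=Q_k\setminus\{0^k,1^k\}$; for $X\subset Q_k$, $Y\subset Q_\ell$, $X\times Y\subset Q_{k+\ell}$ is the set of concatenations $(x,y)$. A $k$-dimensional subcube of $Q_n$ is a set of the form $\{x\in Q_n : x_i=a_i \ \forall i\in T\}$ where $T\subset[n]$ has $|T|=n-k$ and $a_i\in\{0,1\}$ are fixed. -}

module Defs where

open import Data.Bool using (Bool; true; false)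
open import Data.Maybe using (Maybe; just; nothing)
open import Data.Nat using (ℕ)
open import Data.Fin using (Fin)
open import Data.Vec using (Vec; lookup; []; _∷_)
open import Data.Product using (_×_; Σ; ∃)
open import Data.Sum using (_⊎_)
open import Relation.Binary.PropositionalEquality using (_≡_)
open import Relation.Nullary using (¬_)

Q : ℕ → Set
Q n = Vec Bool n

AllEq : ∀ {n} → Bool → Q n → Set
AllEq {n} b x = ∀ (i : Fin n) → lookup x i ≡ b

InQminus : ∀ {n} → Q n → Set
InQminus x = ¬ AllEq false x × ¬ AllEq true x

-- Concatenation (x , y) for x ∈ Q_4, y ∈ Q_3 : we view z ∈ Q_7 via
-- its first 4 and last 3 coordinates.
open import Data.Vec using (take; drop)
first4 : Q 7 → Q 4
first4 z = take 4 z

last3 : Q 7 → Q 3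
last3 z = drop 4 z

Excluded : Q 7 → Set
Excluded z = (AllEq true (first4 z) × InQminus (last3 z))
           ⊎ (AllEq false (first4 z) × AllEq false (last3 z))
           ⊎ (AllEq false (first4 z) × AllEq true (last3 z))

InS : Q 7 → Set
InS z = ¬ Excluded z

-- A subcube pattern: coordinate i is either fixed (just a_i) or free (nothing).
-- The set T of fixed coordinates is the set of i with lookup c i ≡ just _.
Pattern : ℕ → Set
Pattern n = Vec (Maybe Bool) n

InCube : ∀ {n} → Pattern n → Q n → Set
InCube {n} c x = ∀ (i : Fin n) (a : Bool) → lookup c i ≡ just a → lookup x i ≡ a

open import Data.Nat using (zero; suc)

countFree : ∀ {n} → Pattern n → ℕ
countFree [] = 0
countFree (nothing ∷ c) = suc (countFree c)
countFree (just _ ∷ c) = countFree c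

IsSubcube : ∀ {n} → ℕ → Pattern n → Set
IsSubcube k c = countFree c ≡ k

-- The thirty squares are given explicitly (S has 128 − 8 = 120 = 30 · 4 points).
-- Membership in a subcube and in S is decidable and Q 7 is finite, so each of the four
-- partition properties is a decidable proposition, settled by evaluating its decision.
module Submission where

open import Defs
open import Level using (0ℓ)
open import Data.Bool using (Bool; true; false)
open import Data.Bool.Properties using () renaming (_≟_ to _≟ᵇ_)
open import Data.Fin using (Fin)
open import Data.Fin.Properties using (all?; any?) renaming (_≟_ to _≟ᶠ_)
open import Data.Maybe using (Maybe; just; nothing)
open import Data.Nat using (ℕ; zero; suc) renaming (_≟_ to _≟ⁿ_)
open import Data.Product using (Σ-syntax; _×_; _,_; ∃-syntax)
open import Data.Vec using (Vec; lookup; []; _∷_)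
open import Relation.Binary.PropositionalEquality using (_≡_; refl)
open import Relation.Nullary.Decidable
  using (Dec; yes; map′; ¬?; _×-dec_; _⊎-dec_; _→-dec_; from-yes)
open import Relation.Unary using (Pred; Decidable)

Admits : Maybe Bool → Bool → Set
Admits m b = ∀ a → m ≡ just a → b ≡ a

admits? : ∀ m b → Dec (Admits m b)
admits? nothing  b = yes λ _ ()
admits? (just a) b = map′ (λ { b≡a _ refl → b≡a }) (λ h → h a refl) (b ≟ᵇ a)

-- InCube c x unfolds definitionally to ∀ i → Admits (lookup c i) (lookup x i).
inCube? : ∀ {n} (c : Pattern n) → Decidable (InCube c)
inCube? c x = all? λ i → admits? (lookup c i) (lookup x i)

allEq? : ∀ {n} (b : Bool) → Decidable (AllEq {n} b)
allEq? b x = all? λ i → lookup x i ≟ᵇ b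

inQminus? : ∀ {n} → Decidable (InQminus {n})
inQminus? x = ¬? (allEq? false x) ×-dec ¬? (allEq? true x)

excluded? : Decidable Excluded
excluded? z = (allEq? true (first4 z) ×-dec inQminus? (last3 z))
         ⊎-dec (allEq? false (first4 z) ×-dec allEq? false (last3 z))
         ⊎-dec (allEq? false (first4 z) ×-dec allEq? true (last3 z))

inS? : Decidable InS
inS? z = ¬? (excluded? z)

∀-Q? : ∀ {n} {P : Pred (Q n) 0ℓ} → Decidable P → Dec (∀ x → P x)
∀-Q? {zero}  P? = map′ (λ { p [] → p }) (λ h → h []) (P? [])
∀-Q? {suc n} P? =
  map′ (λ { (p₁ , p₀) (true ∷ x) → p₁ x ; (p₁ , p₀) (false ∷ x) → p₀ x })
       (λ h → (λ x → h (true ∷ x)) , (λ x → h (false ∷ x)))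
       (∀-Q? (λ x → P? (true ∷ x)) ×-dec ∀-Q? (λ x → P? (false ∷ x)))

module _ {n m : ℕ} (C : Vec (Pattern n) m) where

  allSubcubes? : ∀ k → Dec (∀ i → IsSubcube k (lookup C i))
  allSubcubes? k = all? λ i → countFree (lookup C i) ≟ⁿ k

  cubesWithin? : {S : Pred (Q n) 0ℓ} → Decidable S → Dec (∀ i x → InCube (lookup C i) x → S x)
  cubesWithin? S? = all? λ i → ∀-Q? λ x → inCube? (lookup C i) x →-dec S? x

  cubesCover? : {S : Pred (Q n) 0ℓ} → Decidable S → Dec (∀ x → S x → ∃[ i ] InCube (lookup C i) x)
  cubesCover? S? = ∀-Q? λ x → S? x →-dec any? λ i → inCube? (lookup C i) x

  cubesDisjoint? : Dec (∀ i j x → InCube (lookup C i) x → InCube (lookup C j) x → i ≡ j)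
  cubesDisjoint? = all? λ i → all? λ j → ∀-Q? λ x →
    inCube? (lookup C i) x →-dec (inCube? (lookup C j) x →-dec (i ≟ᶠ j))

squares : Vec (Pattern 7) 30
squares =
    (nothing ∷ nothing ∷ just true ∷ just true ∷ just false ∷ just false ∷ just false ∷ [])
  ∷ (nothing ∷ nothing ∷ just true ∷ just true ∷ just true ∷ just true ∷ just true ∷ [])
  ∷ (just false ∷ nothing ∷ nothing ∷ just true ∷ just false ∷ just false ∷ just true ∷ [])
  ∷ (just true ∷ just false ∷ nothing ∷ nothing ∷ just false ∷ just false ∷ just true ∷ [])
  ∷ (just false ∷ nothing ∷ nothing ∷ just false ∷ just false ∷ just false ∷ just true ∷ [])
  ∷ (nothing ∷ nothing ∷ just false ∷ just true ∷ just false ∷ just false ∷ just false ∷ [])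
  ∷ (just true ∷ just true ∷ just false ∷ nothing ∷ nothing ∷ just false ∷ just true ∷ [])
  ∷ (just true ∷ just true ∷ just true ∷ just false ∷ nothing ∷ nothing ∷ just true ∷ [])
  ∷ (nothing ∷ nothing ∷ just true ∷ just false ∷ just false ∷ just false ∷ just false ∷ [])
  ∷ (nothing ∷ just true ∷ just false ∷ just false ∷ nothing ∷ just false ∷ just false ∷ [])
  ∷ (just true ∷ just false ∷ just false ∷ just false ∷ nothing ∷ nothing ∷ just false ∷ [])
  ∷ (nothing ∷ nothing ∷ just false ∷ just true ∷ just true ∷ just false ∷ just false ∷ [])
  ∷ (just false ∷ just false ∷ nothing ∷ just false ∷ just true ∷ nothing ∷ just false ∷ [])
  ∷ (nothing ∷ just true ∷ just true ∷ just false ∷ just true ∷ nothing ∷ just false ∷ [])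
  ∷ (just false ∷ nothing ∷ just true ∷ just true ∷ just true ∷ nothing ∷ just false ∷ [])
  ∷ (just true ∷ just false ∷ just true ∷ nothing ∷ just true ∷ nothing ∷ just false ∷ [])
  ∷ (nothing ∷ nothing ∷ just true ∷ just false ∷ just false ∷ just true ∷ just false ∷ [])
  ∷ (just false ∷ nothing ∷ just false ∷ nothing ∷ just false ∷ just true ∷ just false ∷ [])
  ∷ (just false ∷ nothing ∷ just true ∷ just true ∷ just false ∷ just true ∷ nothing ∷ [])
  ∷ (just true ∷ just false ∷ nothing ∷ just true ∷ just false ∷ just true ∷ nothing ∷ [])
  ∷ (just false ∷ nothing ∷ just false ∷ nothing ∷ just false ∷ just true ∷ just true ∷ [])
  ∷ (just false ∷ nothing ∷ just true ∷ just false ∷ nothing ∷ just true ∷ just true ∷ [])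
  ∷ (just true ∷ just false ∷ nothing ∷ just false ∷ nothing ∷ just true ∷ just true ∷ [])
  ∷ (nothing ∷ nothing ∷ just false ∷ just true ∷ just true ∷ just true ∷ just false ∷ [])
  ∷ (nothing ∷ just true ∷ just false ∷ just false ∷ just true ∷ just true ∷ nothing ∷ [])
  ∷ (just true ∷ just true ∷ just false ∷ nothing ∷ just false ∷ just true ∷ nothing ∷ [])
  ∷ (nothing ∷ nothing ∷ just false ∷ just true ∷ just true ∷ just true ∷ just true ∷ [])
  ∷ (just false ∷ nothing ∷ nothing ∷ just false ∷ just true ∷ just false ∷ just true ∷ [])
  ∷ (just false ∷ nothing ∷ nothing ∷ just true ∷ just true ∷ just false ∷ just true ∷ [])
  ∷ (just true ∷ just false ∷ nothing ∷ nothing ∷ just true ∷ just false ∷ just true ∷ [])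
  ∷ []

lemma2p4 : Σ[ C ∈ Vec (Pattern 7) 30 ]
             ((∀ (i : Fin 30) → IsSubcube 2 (lookup C i))
              × (∀ (i : Fin 30) (x : Q 7) → InCube (lookup C i) x → InS x)
              × (∀ (x : Q 7) → InS x → ∃[ i ] InCube (lookup C i) x)
              × (∀ (i j : Fin 30) (x : Q 7) → InCube (lookup C i) x → InCube (lookup C j) x → i ≡ j))
lemma2p4 = squares
         , from-yes (allSubcubes? squares 2)
         , from-yes (cubesWithin? squares inS?)
         , from-yes (cubesCover? squares inS?)
         , from-yes (cubesDisjoint? squares)
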